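{- (a) Let $(L,\vee,\wedge,0,1)$ be a bounded lattice equipped with an antitone involution $\sim$ and, for each $a\in L$, a mapping $x\mapsto x^{a}$ of $[a,1]$ into itself which is antitone and extensive and satisfies $1^{a}=a$; write $\mathcal{L}=(L,\vee,\wedge,\{{}^{a}\mid a\in L\},\sim,0,1)$. Define, for all $x,y\in L$, $$x\rightarrow y:=(\sim x\vee\sim y)^{\sim x},\qquad x\odot y:=\sim(y\rightarrow\sim x)=\sim\big[(x\vee\sim y)^{\sim y}\big].$$ Then $\mathcal{G}(\mathcal{L})=(L,\vee,\wedge,\odot,\rightarrow,0,1)$ is an involutive right-residuated l-groupoid in which $\rceil x=\sim x$ for all $x\in L$, and its derived implication $x\Rightarrow y:=\rceil y\rightarrow\rceil x$ satisfies condition (I3). (b) Let $\mathcal{G}=(L,\vee,\wedge,\odot,\rightarrow,0,1)$ be an involutive right-residuated l-groupoid whose derived implication $\Rightarrow$ satisfies condition (I3). Let $\sim z:=z\rightarrow 0$ for all $z\in L$, and for all $a,x\in L$ with $x\ge a$ define $x^{a}:=x\Rightarrow a=\rceil a\rightarrow\rceil x$. Then $\mathcal{L}(\mathcal{G})=(L,\vee,\wedge,\{{}^{a}\mid a\in L\},\sim,0,1)$ is a bounded lattice with the antitone involution $\sim$ and sectionally antitone extensive mappings $x\mapsto x^{a}$, $x\in[a,1]$, satisfying $1^{a}=a$ for all $a\in L$. (c) These two constructions are mutually inverse: $\mathcal{G}(\mathcal{L}(\mathcal{G}))=\mathcal{G}$ for every $\mathcal{G}$ as in (b), and $\mathcal{L}(\mathcal{G}(\mathcal{L}))=\mathcal{L}$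 for every $\mathcal{L}$ as in (a).
   Context: A right-residuated l-groupoid is an algebra $\mathcal{G}=(L,\vee,\wedge,\odot,\rightarrow,0,1)$ of type $(2,2,2,2,0,0)$ such that $(L,\vee,\wedge)$ is a lattice with least element $0$ and greatest element $1$, $(L,\odot)$ is a groupoid with $1\odot x=x$ for all $x$, and $x\odot y\le z$ if and only if $x\le y\rightarrow z$ for all $x,y,z\in L$. Put $\rceil x:=x\rightarrow 0$. $\mathcal{G}$ is involutive if $x\mapsto\rceil x$ is an antitone involution, i.e. $x\le y$ implies $\rceil y\le\rceil x$, and $\rceil\rceil x=x$ for all $x$. The derived implication of $\mathcal{G}$ is $x\Rightarrow y:=\rceil y\rightarrow\rceil x$. Condition (I3) for a binary operation $\Rightarrow$ on a lattice is the identity $[(x\Rightarrow y)\Rightarrow y]\wedge(x\vee y)=x\vee y$ for all $x,y$. For $a\in L$, $[a,1]=\{x\in L\mid a\le x\le 1\}$. A mapping $x\mapsto x^{a}$ of $[a,1]$ into itself is antitone if $x\le y$ implies $x^{a}\ge y^{a}$, and extensive if $x^{aa}:=(x^{a})^{a}\ge x$ for all $x\in[a,1]$. -}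

module Defs where

open import Level using (Level; _⊔_) renaming (suc to lsuc)
open import Data.Product using (_×_; _,_)
open import Relation.Binary.Core using (Rel)
open import Relation.Binary.PropositionalEquality using (_≡_)
open import Relation.Binary.Lattice.Structures using (IsBoundedLattice)

record BLattice {a : Level} (A : Set a) : Set (lsuc a) where
  field
    _≤_ : Rel A a
    _∨_ : A → A → A
    _∧_ : A → A → A
    ⊤ : A
    ⊥ : A
    isBoundedLattice : IsBoundedLattice _≡_ _≤_ _∨_ _∧_ ⊤ ⊥
  infix 4 _≤_
  infixr 6 _∨_
  infixr 7 _∧_

-- The family of sectional maps x ↦ x^a (x ∈ [a,1]) is given by a total
-- function  sec a x  whose values are only constrained for a ≤ x.

record LStr {a : Level} (A : Set a) : Set (lsuc a) where
  field
    lat : BLattice A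
    ∼ : A → A
    sec : A → A → A
  open BLattice lat public

record IsLStr {a : Level} {A : Set a} (L : LStr A) : Set a where
  open LStr L
  field
    ∼-antitone : ∀ x y → x ≤ y → ∼ y ≤ ∼ x
    ∼-involutive : ∀ x → ∼ (∼ x) ≡ x
    sec-into : ∀ s x → s ≤ x → s ≤ sec s x
    sec-antitone : ∀ s x y → s ≤ x → x ≤ y → sec s y ≤ sec s x
    sec-extensive : ∀ s x → s ≤ x → x ≤ sec s (sec s x)
    sec-top : ∀ s → sec s ⊤ ≡ s

record GStr {a : Level} (A : Set a) : Set (lsuc a) where
  field
    lat : BLattice A
    _⊙_ : A → A → A
    _⇾_ : A → A → A
  open BLattice lat public

  ⌉ : A → A
  ⌉ x = x ⇾ ⊥

  _⇒_ : A → A → A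
  x ⇒ y = ⌉ y ⇾ ⌉ x

record IsRRLGroupoid {a : Level} {A : Set a} (G : GStr A) : Set a where
  open GStr G
  field
    ⊙-identityˡ : ∀ x → ⊤ ⊙ x ≡ x
    residuation₁ : ∀ x y z → x ⊙ y ≤ z → x ≤ y ⇾ z
    residuation₂ : ∀ x y z → x ≤ y ⇾ z → x ⊙ y ≤ z

record IsInvolutive {a : Level} {A : Set a} (G : GStr A) : Set a where
  open GStr G
  field
    ⌉-antitone : ∀ x y → x ≤ y → ⌉ y ≤ ⌉ x
    ⌉-involutive : ∀ x → ⌉ (⌉ x) ≡ x

IsInvRRLGroupoid : {a : Level} {A : Set a} → GStr A → Set a
IsInvRRLGroupoid G = IsRRLGroupoid G × IsInvolutive G

I3 : {a : Level} {A : Set a} → GStr A → Set a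
I3 G = ∀ x y → (((x ⇒ y) ⇒ y) ∧ (x ∨ y)) ≡ (x ∨ y)
  where open GStr G

GofL : {a : Level} {A : Set a} → LStr A → GStr A
GofL {A = A} L = record { lat = lat ; _⊙_ = _⊙'_ ; _⇾_ = _⇾'_ }
  where
  open LStr L
  _⇾'_ : A → A → A
  x ⇾' y = sec (∼ x) (∼ x ∨ ∼ y)
  _⊙'_ : A → A → A
  x ⊙' y = ∼ (y ⇾' ∼ x)

LofG : {a : Level} {A : Set a} → GStr A → LStr A
LofG G = record { lat = lat ; ∼ = λ z → z ⇾ ⊥ ; sec = λ s x → x ⇒ s }
  where open GStr G

-- Write gₐ u := (a ∨ u)ᵃ. Antitonicity and extensivity of x ↦ xᵃ on [a,1]
-- make gₐ self-adjoint (v ≤ gₐ u iff u ≤ gₐ v), and x → y is g_{∼x}(∼y).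
-- Conjugating by ∼ turns this self-adjunction into the residuation law
-- for ⊙, while x ⇒ y = g_y x makes (I3) the inequality x ∨ y ≤ g_y (g_y x).
-- Conversely, in an involutive residuated l-groupoid ⇒ is antitone in its
-- first argument, (I3) gives extensivity, and the round trip
-- G(L(G)) returns x → (x ∧ y) = x → y; the products then agree because a
-- residuated product is determined by its residuum.
module Submission where

open import Defs
open import Level using (Level)
open import Data.Product using (_×_; _,_; proj₁; proj₂)
open import Relation.Binary.PropositionalEquality using (_≡_; refl; sym; trans; cong; cong₂; subst; subst₂; module ≡-Reasoning)
open import Relation.Binary.Lattice.Bundles using (BoundedLattice)
import Relation.Binary.Lattice.Properties.JoinSemilattice as JoinSemilatticeProperties
import Relation.Binary.Lattice.Properties.MeetSemilattice as MeetSemilatticeProperties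
import Relation.Binary.Reasoning.PartialOrder as ≤-Reasoning

module LatticeFacts {ℓ : Level} {A : Set ℓ} (B : BLattice A) where

  boundedLattice : BoundedLattice ℓ ℓ ℓ
  boundedLattice = record { isBoundedLattice = BLattice.isBoundedLattice B }

  open BoundedLattice boundedLattice public renaming (refl to ≤-refl; trans to ≤-trans)
  open JoinSemilatticeProperties joinSemilattice public using (x≤y⇒x∨y≈y)
  open MeetSemilatticeProperties meetSemilattice public using (y≤x⇒x∧y≈y)
  open ≤-Reasoning poset

  x∧y≡y⇒y≤x : ∀ {x y} → x ∧ y ≡ y → y ≤ x
  x∧y≡y⇒y≤x {x} {y} eq = subst (_≤ x) eq (x∧y≤x x y)

  residuum-determines-product :
    ∀ {_⊙₁_ _⊙₂_ _⇾_ : A → A → A} →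
    (∀ x y z → x ⊙₁ y ≤ z → x ≤ y ⇾ z) → (∀ x y z → x ≤ y ⇾ z → x ⊙₁ y ≤ z) →
    (∀ x y z → x ⊙₂ y ≤ z → x ≤ y ⇾ z) → (∀ x y z → x ≤ y ⇾ z → x ⊙₂ y ≤ z) →
    ∀ x y → x ⊙₁ y ≡ x ⊙₂ y
  residuum-determines-product res₁ res₁′ res₂ res₂′ x y = antisym
    (res₁′ x y _ (res₂ x y _ ≤-refl))
    (res₂′ x y _ (res₁ x y _ ≤-refl))

  module AntitoneInvolution
    (n : A → A) (antitone : ∀ x y → x ≤ y → n y ≤ n x) (involutive : ∀ x → n (n x) ≡ x)
    where

    ≤n⇒≤n : ∀ {x y} → x ≤ n y → y ≤ n x
    ≤n⇒≤n {x} {y} p = subst (_≤ n x) (involutive y) (antitone x (n y) p)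

    n≤⇒n≤ : ∀ {x y} → n x ≤ y → n y ≤ x
    n≤⇒n≤ {x} {y} p = subst (n y ≤_) (involutive x) (antitone (n x) y p)

    n-⊥ : n ⊥ ≡ ⊤
    n-⊥ = antisym (maximum (n ⊥)) (≤n⇒≤n (minimum (n ⊤)))

    n-⊤ : n ⊤ ≡ ⊥
    n-⊤ = antisym (n≤⇒n≤ (maximum (n ⊥))) (minimum (n ⊤))

    n-∨-n : ∀ x y → n (n x ∨ n y) ≡ x ∧ y
    n-∨-n x y = antisym
      (∧-greatest (n≤⇒n≤ (x≤x∨y (n x) (n y))) (n≤⇒n≤ (y≤x∨y (n x) (n y))))
      (≤n⇒≤n (∨-least (antitone _ _ (x∧y≤x x y)) (antitone _ _ (x∧y≤y x y))))

  module SectionMap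
    (a : A) (f : A → A)
    (into : ∀ x → a ≤ x → a ≤ f x)
    (antitone : ∀ x y → a ≤ x → x ≤ y → f y ≤ f x)
    (extensive : ∀ x → a ≤ x → x ≤ f (f x))
    where

    g : A → A
    g u = f (a ∨ u)

    a≤g : ∀ u → a ≤ g u
    a≤g u = into (a ∨ u) (x≤x∨y a u)

    g-self-adjoint : ∀ {u v} → v ≤ g u → u ≤ g v
    g-self-adjoint {u} {v} v≤gu = begin
      u               ≤⟨ y≤x∨y a u ⟩
      a ∨ u           ≤⟨ extensive (a ∨ u) (x≤x∨y a u) ⟩
      f (g u)         ≤⟨ antitone (a ∨ v) (g u) (x≤x∨y a v) (∨-least (a≤g u) v≤gu) ⟩
      g v             ∎

    ≤gg : ∀ u → u ≤ g (g u)
    ≤gg u = g-self-adjoint (≤-refl {g u})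

    g≡f : ∀ {x} → a ≤ x → g x ≡ f x
    g≡f a≤x = cong f (x≤y⇒x∨y≈y a≤x)

module FromLStr {ℓ : Level} {A : Set ℓ} (L : LStr A) (H : IsLStr L) where
  open LStr L using (lat; ∼; sec)
  open IsLStr H
  open LatticeFacts lat
  open AntitoneInvolution ∼ ∼-antitone ∼-involutive
  module S (s : A) = SectionMap s (sec s) (sec-into s) (sec-antitone s) (sec-extensive s)
  open S using (g)
  open GStr (GofL L) using (_⊙_; _⇾_; ⌉; _⇒_)

  ⌉≡∼ : ∀ x → ⌉ x ≡ ∼ x
  ⌉≡∼ x = begin
    g (∼ x) (∼ ⊥)  ≡⟨ cong (g (∼ x)) n-⊥ ⟩
    g (∼ x) ⊤      ≡⟨ S.g≡f (∼ x) (maximum (∼ x)) ⟩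
    sec (∼ x) ⊤    ≡⟨ sec-top (∼ x) ⟩
    ∼ x            ∎
    where open ≡-Reasoning

  ⊙≡∼g : ∀ x y → x ⊙ y ≡ ∼ (g (∼ y) x)
  ⊙≡∼g x y = cong (λ t → ∼ (g (∼ y) t)) (∼-involutive x)

  residuation₁ : ∀ x y z → x ⊙ y ≤ z → x ≤ y ⇾ z
  residuation₁ x y z h = S.g-self-adjoint (∼ y) (n≤⇒n≤ (subst (_≤ z) (⊙≡∼g x y) h))

  residuation₂ : ∀ x y z → x ≤ y ⇾ z → x ⊙ y ≤ z
  residuation₂ x y z h = subst (_≤ z) (sym (⊙≡∼g x y)) (n≤⇒n≤ (S.g-self-adjoint (∼ y) h))

  ⊙-identityˡ : ∀ x → ⊤ ⊙ x ≡ x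
  ⊙-identityˡ x = trans (cong (λ t → ∼ (x ⇾ t)) n-⊤)
                        (trans (cong ∼ (⌉≡∼ x)) (∼-involutive x))

  isInvRRLGroupoid : IsInvRRLGroupoid (GofL L)
  isInvRRLGroupoid =
      record { ⊙-identityˡ = ⊙-identityˡ ; residuation₁ = residuation₁ ; residuation₂ = residuation₂ }
    , record
      { ⌉-antitone = λ x y p → subst₂ _≤_ (sym (⌉≡∼ y)) (sym (⌉≡∼ x)) (∼-antitone x y p)
      ; ⌉-involutive = λ x → trans (⌉≡∼ (⌉ x)) (trans (cong ∼ (⌉≡∼ x)) (∼-involutive x))
      }

  ⇒≡g : ∀ x y → x ⇒ y ≡ g y x
  ⇒≡g x y = trans (cong₂ _⇾_ (⌉≡∼ y) (⌉≡∼ x))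
                  (cong₂ g (∼-involutive y) (∼-involutive x))

  i3 : I3 (GofL L)
  i3 x y = y≤x⇒x∧y≈y (subst (x ∨ y ≤_) (sym ⇒⇒≡gg) (∨-least (S.≤gg y x) (S.a≤g y _)))
    where
    ⇒⇒≡gg : (x ⇒ y) ⇒ y ≡ g y (g y x)
    ⇒⇒≡gg = trans (⇒≡g (x ⇒ y) y) (cong (g y) (⇒≡g x y))

  sec-round-trip : ∀ s x → s ≤ x → x ⇒ s ≡ sec s x
  sec-round-trip s x s≤x = trans (⇒≡g x s) (S.g≡f s s≤x)

module FromGStr {ℓ : Level} {A : Set ℓ} (G : GStr A) (H : IsInvRRLGroupoid G) (i3 : I3 G) where
  open GStr G using (lat; _⊙_; _⇾_; ⌉; _⇒_)
  open IsRRLGroupoid (proj₁ H)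
  open IsInvolutive (proj₂ H)
  open LatticeFacts lat
  open AntitoneInvolution ⌉ ⌉-antitone ⌉-involutive

  ⇾-monoʳ : ∀ x {y z} → y ≤ z → x ⇾ y ≤ x ⇾ z
  ⇾-monoʳ x p = residuation₁ _ x _ (≤-trans (residuation₂ _ x _ ≤-refl) p)

  ⊙-monoˡ : ∀ y {x x′} → x ≤ x′ → x ⊙ y ≤ x′ ⊙ y
  ⊙-monoˡ y p = residuation₂ _ y _ (≤-trans p (residuation₁ _ y _ ≤-refl))

  x⊙y≤y : ∀ x y → x ⊙ y ≤ y
  x⊙y≤y x y = subst (x ⊙ y ≤_) (⊙-identityˡ y) (⊙-monoˡ y (maximum x))

  ⇒-antitoneˡ : ∀ y {x x′} → x ≤ x′ → x′ ⇒ y ≤ x ⇒ y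
  ⇒-antitoneˡ y p = ⇾-monoʳ _ (⌉-antitone _ _ p)

  ⊤⇒y≡y : ∀ y → ⊤ ⇒ y ≡ y
  ⊤⇒y≡y y = trans (cong (⌉ y ⇾_) n-⊤) (⌉-involutive y)

  isLStr : IsLStr (LofG G)
  isLStr = record
    { ∼-antitone = ⌉-antitone
    ; ∼-involutive = ⌉-involutive
    ; sec-into = λ s x _ → subst (_≤ x ⇒ s) (⊤⇒y≡y s) (⇒-antitoneˡ s (maximum x))
    ; sec-antitone = λ s x y _ → ⇒-antitoneˡ s
    ; sec-extensive = λ s x _ → ≤-trans (x≤x∨y x s) (x∧y≡y⇒y≤x (i3 x s))
    ; sec-top = ⊤⇒y≡y
    }

  ⇾-∧ : ∀ x y → x ⇾ (x ∧ y) ≡ x ⇾ y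
  ⇾-∧ x y = antisym (⇾-monoʳ x (x∧y≤y x y))
    (residuation₁ _ x _ (∧-greatest (x⊙y≤y _ x) (residuation₂ _ x _ ≤-refl)))

  open GStr (GofL (LofG G)) using () renaming (_⊙_ to _⊙′_; _⇾_ to _⇾′_)
  module L′ = FromLStr (LofG G) isLStr

  ⇾-round-trip : ∀ x y → x ⇾′ y ≡ x ⇾ y
  ⇾-round-trip x y = trans (cong₂ _⇾_ (⌉-involutive x) (n-∨-n x y)) (⇾-∧ x y)

  ⊙-round-trip : ∀ x y → x ⊙′ y ≡ x ⊙ y
  ⊙-round-trip = residuum-determines-product
    (λ x y z h → subst (x ≤_) (⇾-round-trip y z) (L′.residuation₁ x y z h))
    (λ x y z h → L′.residuation₂ x y z (subst (x ≤_) (sym (⇾-round-trip y z)) h))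
    residuation₁ residuation₂

theorem1 : {ℓ : Level} {A : Set ℓ} →
    -- (a)
    ((L : LStr A) → IsLStr L →
        IsInvRRLGroupoid (GofL L)
      × (∀ x → GStr.⌉ (GofL L) x ≡ LStr.∼ L x)
      × I3 (GofL L))
    -- (b)
    × ((G : GStr A) → IsInvRRLGroupoid G → I3 G → IsLStr (LofG G))
    -- (c)  G(L(G)) = G  and  L(G(L)) = L
    × ((G : GStr A) → IsInvRRLGroupoid G → I3 G →
          GStr.lat (GofL (LofG G)) ≡ GStr.lat G
        × (∀ x y → GStr._⊙_ (GofL (LofG G)) x y ≡ GStr._⊙_ G x y)
        × (∀ x y → GStr._⇾_ (GofL (LofG G)) x y ≡ GStr._⇾_ G x y))
    × ((L : LStr A) → IsLStr L →
          LStr.lat (LofG (GofL L)) ≡ LStr.lat L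
        × (∀ x → LStr.∼ (LofG (GofL L)) x ≡ LStr.∼ L x)
        × (∀ s x → BLattice._≤_ (LStr.lat L) s x →
             LStr.sec (LofG (GofL L)) s x ≡ LStr.sec L s x))
theorem1 =
    (λ L H → let open FromLStr L H in isInvRRLGroupoid , ⌉≡∼ , i3)
  , (λ G H i3 → FromGStr.isLStr G H i3)
  , (λ G H i3 → let open FromGStr G H i3 in refl , ⊙-round-trip , ⇾-round-trip)
  , (λ L H → let open FromLStr L H in refl , ⌉≡∼ , sec-round-trip)
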